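{- Let $\mathcal P$ be a cyclic proof, $\nu$ a node, $\tau\in\mathrm{TV}_{\mathcal A}(\nu)$, $\tau'\in\mathrm{TV}_{\mathcal C}(\nu)$, $n>0$, and ${\sim}\in\{<,\le\}$. If $L_{\mathscr B^{(\mathcal P,\nu)}_{(\tau,\tau')}}\sim L_{\mathscr A(n)^{(\mathcal P,\nu)}_{(\tau,\tau')}}$, then $L_{\mathscr B^{(\mathcal P,\nu)}_{(\tau,\tau')}}\sim L_{\mathscr A^{(\mathcal P,\nu)}_{(\tau,\tau')}}$.
   Context: Abstract cyclic entailment systems. Fix sets $\mathcal{A}$ (antecedents) and $\mathcal{C}$ (consequents); a sequent is a pair $(A,C)$, written $A\vdash C$. A rule instance is a pair $(S,(S_1,\dots,S_n))$ of a sequent and a finite sequence of sequents; axiomatic if $n=0$. Rules are sets of rule instances indexed by a set $\mathbb R$; the system uses a fixed set $\vec r$ of indices. A cyclic pre-proof $\mathcal P$ is a finite directed graph whose nodes have ordered children, each node $\nu$ labelled by a sequent $\mathrm{Seq}(\nu)$ and a rule index in $\vec r$ such that $\mathrm{Seq}(\nu)$ with its children's sequents forms an instance of that rule; $\nu$ is axiomatic iff it has no children. $\mathrm{Nodes}(\mathcal P)$ is its node set; $(\nu,\nu')\in\mathcal P$ means $\nu'$ is a child of $\nu$. Semantics: set $\mathcal M$ of models and relations $\models_{\mathcal A},\models_{\mathcal C}$; $A\vdash C$ is valid if every $m\models_{\mathcal A}A$ has $m\models_{\mathcal C}C$. Trace values: disjoint sets $\mathcal T_{\mathcal A},\mathcal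 T_{\mathcal C}$; maps $\mathrm{TV}_{\mathcal A},\mathrm{TV}_{\mathcal C}$ giving finite sets of trace values to antecedents (resp. consequents), extended to sequents and nodes; $\mathrm{TV}_{\mathcal A}(\mathcal P)=\bigcup_\nu\mathrm{TV}_{\mathcal A}(\nu)$, likewise $\mathrm{TV}_{\mathcal C}(\mathcal P)$. $\mathcal O$ is an initial segment of the ordinals. A computable trace pair function gives, for each non-axiomatic instance and premise index, partial functions $\delta_1$ (on pairs of antecedent trace values of conclusion and premise) and $\delta_2$ (on consequent ones) into $\mathcal O$, written $\delta_k^{(\nu,\nu')}$ for node $\nu$ and child $\nu'$. A value $\tau$ is terminal for $\nu$ if for no child $\nu'$ and $\tau'$ is $(\tau,\tau')$ in the domain of the same-side $\delta_k^{(\nu,\nu')}$. A cyclic proof is a cyclic pre-proof in which every infinite path $\vec\nu$ has a tail followed by a sequence $\vec\tau$ in $\mathcal T_{\mathcal A}$ with each $(\vec\tau_i,\vec\tau_{i+1})\in\mathrm{dom}(\delta_1^{(\vec\nu_i,\vec\nu_{i+1})})$ and value $>0$ at infinitely many positions. Ordinal trace function: a fixed partial $\mathrm{Ord}:(\mathcal T_{\mathcal A}\cup\mathcal T_{\mathcal C})\times\mathcal M\rightharpoonup\mathcal O$; $\underline 1$ its least value. A fixed exclusion predicate on pairs (rule instance $(A\vdash C,\vec S)$, $\tau\in\mathrm{TV}_{\mathcal C}(C)$) holds only if no $m\models_{\mathcal A}A$ has $\mathrm{Ord}(\tau,m)$ defined. For an instance $(A\vdash C,\vec S)$ and terminal $\tau\in\mathrm{TV}_{\mathcal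 C}(C)$, $\tau$ is ground w.r.t. it if, whenever $A\vdash C$ is valid, every $m\models_{\mathcal A}A$ with $\mathrm{Ord}(\tau,m)$ defined has $\mathrm{Ord}(\tau,m)=\underline 1$. $S=A\vdash C$ equates $\tau\in\mathrm{TV}_{\mathcal A}(A)$ and $\tau'\in\mathrm{TV}_{\mathcal C}(C)$ ($\tau=_S\tau'$) if, whenever $S$ is valid, every $m\models_{\mathcal A}A$ with $\mathrm{Ord}(\tau',m)$ defined has $\mathrm{Ord}(\tau,m)=\mathrm{Ord}(\tau',m)$. Weighted automata over alphabet $\Sigma$ and semiring $(V,\oplus,\otimes)$: tuples $(Q,q_I,F,\Delta,\gamma)$, $\Delta\subseteq Q\times\Sigma\times Q$, $\gamma:\Delta\to V$. A run over $w=\sigma_1\dots\sigma_n$ is $q_0\sigma_1q_1\dots\sigma_nq_n$ with $q_0=q_I$ and $(q_{i-1},\sigma_i,q_i)\in\Delta$; accepting if $q_n\in F$; value $\gamma(q_0,\sigma_1,q_1)\otimes\dots\otimes\gamma(q_{n-1},\sigma_n,q_n)$ if accepting, $\bot$ otherwise. $L(w)=\bot$ if no run over $w$ exists, otherwise the $\oplus$ of all run values over $w$. $L_1\le L_2$ iff $L_1(w)\le L_2(w)$ for all words; $L_1<L_2$ iff $L_1(w)<L_2(w)$ for all $w$ with $L_1(w)\ne\bot$. Semiring: $\mathcal O\cup\{\bot\}$, $\bot$ below all ordinals, $\oplus=\max$, $\alpha\otimes\beta=\beta+\alpha$ (ordinal addition), $\bot$ absorbing. Construction: $\Sigma_{\mathcal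 P}=\mathrm{Nodes}(\mathcal P)\cup(\wp(\mathrm{TV}_{\mathcal A}(\mathcal P))\times\mathrm{TV}_{\mathcal C}(\mathcal P))$; for $\tau\in\mathrm{TV}_{\mathcal C}(\nu)$, $T_\nu(\tau)=\{\tau'\in\mathrm{TV}_{\mathcal A}(\nu):\tau'=_{\mathrm{Seq}(\nu)}\tau\}$. Fix node $\nu_0$, $\tau_1\in\mathrm{TV}_{\mathcal A}(\nu_0)$, $\tau_2\in\mathrm{TV}_{\mathcal C}(\nu_0)$. Common transitions (on states $(\nu,\tau)$): $(q_{\mathcal A},\nu_0,(\nu_0,\tau_1))$; $((\nu,\tau),\nu',(\nu',\tau'))$ for $(\nu,\nu')\in\mathcal P$, $(\tau,\tau')\in\mathrm{dom}(\delta_1^{(\nu,\nu')})$; $((\nu,\tau),(T_\nu(\tau'),\tau'),\bot)$ for $\nu$ axiomatic, $\tau'\in\mathrm{TV}_{\mathcal C}(\nu)$, $\tau\in T_\nu(\tau')$. $\mathscr A^{(\mathcal P,\nu_0)}_{(\tau_1,\tau_2)}$: states $(\mathrm{Nodes}(\mathcal P)\times\mathrm{TV}_{\mathcal A}(\mathcal P))\uplus\{\bot,\top,q_{\mathcal A}\}$, initial $q_{\mathcal A}$, all other states final; the common transitions plus $((\nu,\tau),\nu',\top)$ for $(\nu,\nu')\in\mathcal P$ and $(\top,\nu,\top)$ for all nodes $\nu$. $\mathscr A(n)^{(\mathcal P,\nu_0)}_{(\tau_1,\tau_2)}$ ($n>0$): states $(\mathrm{Nodes}(\mathcal P)\times\mathrm{TV}_{\mathcal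 A}(\mathcal P))\uplus\{\bot,q_{\mathcal A}\}\uplus\{\top^i_\nu:\nu\in\mathrm{Nodes}(\mathcal P),0<i\le n\}$, initial $q_{\mathcal A}$, all other states final; the common transitions plus $((\nu,\tau),\nu',\top^1_{\nu'})$ for $(\nu,\nu')\in\mathcal P$, $(\top^i_\nu,\nu',\top^i_\nu)$ for $0<i\le n$, $\nu'\ne\nu$, and $(\top^i_\nu,\nu,\top^{i+1}_\nu)$ for $0<i<n$. In both, a transition from $(\nu,\tau)$ to $(\nu',\tau')$ has weight $\delta_1^{(\nu,\nu')}(\tau,\tau')$; all others $0$. $\mathscr B^{(\mathcal P,\nu_0)}_{(\tau_1,\tau_2)}$: states $(\mathrm{Nodes}(\mathcal P)\times\mathrm{TV}_{\mathcal C}(\mathcal P))\uplus\{\bot,q_{\mathcal C}\}$, initial $q_{\mathcal C}$; final states: $\bot$, all $(\nu,\tau)$ with $\nu$ non-axiomatic, $\tau$ terminal for $\nu$ and not excluded by $\nu$, and all $(\nu,\tau)$ with $\nu$ axiomatic, $\tau$ ground w.r.t. $\nu$ and not excluded by $\nu$; transitions $(q_{\mathcal C},\nu_0,(\nu_0,\tau_2))$; $((\nu,\tau),\nu',(\nu',\tau'))$ for $(\nu,\nu')\in\mathcal P$, $(\tau,\tau')\in\mathrm{dom}(\delta_2^{(\nu,\nu')})$; $((\nu,\tau),(T_\nu(\tau),\tau),\bot)$ for $\tau\in\mathrm{TV}_{\mathcal C}(\nu)$, $\nu$ axiomatic, $\tau$ not ground w.r.t. $\nu$, not excluded by $\nu$;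 transitions from $(\nu,\tau)$ to $(\nu',\tau')$ have weight $\delta_2^{(\nu,\nu')}(\tau,\tau')$, others $0$. -}

module Defs where

open import Level using (0ℓ)
open import Data.Nat using (ℕ; zero; suc; _+_; _≤_) renaming (_<_ to _<ℕ_)
open import Data.Fin using (Fin; toℕ)
open import Data.List using (List; []; _∷_)
open import Data.List.Membership.Propositional using (_∈_)
open import Data.Maybe using (Maybe; just; nothing)
open import Data.Product using (Σ; ∃; _×_; _,_; proj₁; proj₂)
open import Data.Sum using (_⊎_; inj₁; inj₂)
open import Relation.Nullary using (¬_)
open import Relation.Binary.PropositionalEquality using (_≡_; _≢_)
open import Relation.Binary.Structures using (IsStrictTotalOrder)
open import Induction.WellFounded using (WellFounded)

-- The ordinal segment 𝒪 (an initial segment of the ordinals, closed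
-- under ordinal addition), given up to isomorphism: a well-founded
-- strict total order with least element 𝟘 and an addition characterised
-- by the transfinite recursion  a ⊹ b = least x with a ≼ x and
-- a ⊹ c ≺ x for all c ≺ b  (which is exactly ordinal addition).

record OrdinalSegment : Set₁ where
  infix 4 _≺_ _≼_
  infixl 6 _⊹_
  field
    𝒪       : Set
    _≺_     : 𝒪 → 𝒪 → Set
    isSTO   : IsStrictTotalOrder _≡_ _≺_
    ≺-wf    : WellFounded _≺_
    𝟘       : 𝒪
    𝟘-least : ∀ a → ¬ (a ≺ 𝟘)
    _⊹_     : 𝒪 → 𝒪 → 𝒪

  _≼_ : 𝒪 → 𝒪 → Set
  a ≼ b = a ≺ b ⊎ a ≡ b

  field
    ⊹-lower : ∀ a b → a ≼ a ⊹ b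
    ⊹-above : ∀ a b c → c ≺ b → a ⊹ c ≺ a ⊹ b
    ⊹-least : ∀ a b x → a ≼ x → (∀ c → c ≺ b → a ⊹ c ≺ x) → a ⊹ b ≼ x

-- The semiring 𝒪 ∪ {⊥}: ⊥ = nothing, ⊕ = max, α ⊗ β = β + α.

module OrdSemiring (OS : OrdinalSegment) where
  open OrdinalSegment OS

  V : Set
  V = Maybe 𝒪

  ⊥v : V
  ⊥v = nothing

  _⊗_ : V → V → V
  just a ⊗ just b = just (b ⊹ a)
  _      ⊗ _      = nothing

  data _≤v_ : V → V → Set where
    ⊥≤   : ∀ {y} → nothing ≤v y
    j≤j  : ∀ {a b} → a ≼ b → just a ≤v just b

  data _<v_ : V → V → Set where
    ⊥<   : ∀ {b} → nothing <v just b
    j<j  : ∀ {a b} → a ≺ b → just a <v just b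

-- Weighted automata over 𝒪 ∪ {⊥}.  The transition relation carries its
-- weight: Trans q σ q' v  means (q,σ,q') ∈ Δ with γ(q,σ,q') = v.

module Automata (OS : OrdinalSegment) where
  open OrdinalSegment OS
  open OrdSemiring OS

  record WAut (Sig : Set) : Set₁ where
    field
      Q     : Set
      qI    : Q
      Final : Q → Set
      Trans : Q → Sig → Q → V → Set

  module _ {Sig : Set} (A : WAut Sig) where
    open WAut A

    data Path : Q → List Sig → Q → V → Set where
      []  : ∀ {q} → Path q [] q (just 𝟘)
      _∷_ : ∀ {q σ q' w q'' g v} → Trans q σ q' g → Path q' w q'' v →
            Path q (σ ∷ w) q'' (g ⊗ v)

    HasRun : List Sig → Set
    HasRun w = Σ Q λ q → Σ V λ v → Path qI w q v

    RunValue : List Sig → V → Set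
    RunValue w x = Σ Q λ q → Σ V λ v → Path qI w q v ×
                   ((Final q × x ≡ v) ⊎ (¬ Final q × x ≡ ⊥v))

    IsL : List Sig → V → Set
    IsL w x = (¬ HasRun w × x ≡ ⊥v)
            ⊎ (RunValue w x × (∀ y → RunValue w y → y ≤v x))

  data Cmp : Set where
    lt le : Cmp

  LangCmp : {Sig : Set} → Cmp → WAut Sig → WAut Sig → Set
  LangCmp le A₁ A₂ = ∀ w x y → IsL A₁ w x → IsL A₂ w y → x ≤v y
  LangCmp lt A₁ A₂ = ∀ w x y → IsL A₁ w x → IsL A₂ w y → x ≢ ⊥v → x <v y

-- Abstract cyclic entailment systems with trace values and ordinal
-- trace function.  Finite sequences of sequents are Fin n → Sequent.

record System (OS : OrdinalSegment) : Set₁ where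
  open OrdinalSegment OS
  field
    Ante Cons : Set
    RuleIdx   : Set
    Rule      : RuleIdx → (Ante × Cons) → (n : ℕ) → (Fin n → Ante × Cons) → Set
    r⃗         : RuleIdx → Set
    Model     : Set
    _⊨A_      : Model → Ante → Set
    _⊨C_      : Model → Cons → Set
    -- trace values (disjoint: separate types)
    TA TC     : Set
    TVA       : Ante → List TA
    TVC       : Cons → List TC
    -- trace pair function: for an instance and premise index i,
    -- partial maps (nothing = undefined) into 𝒪
    δ₁ : (S : Ante × Cons) (n : ℕ) (Ss : Fin n → Ante × Cons) → Fin n →
         TA → TA → Maybe 𝒪
    δ₂ : (S : Ante × Cons) (n : ℕ) (Ss : Fin n → Ante × Cons) → Fin n →
         TC → TC → Maybe 𝒪
    δ₁-dom : ∀ S n Ss i τ τ' o → δ₁ S n Ss i τ τ' ≡ just o →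
             τ ∈ TVA (proj₁ S) × τ' ∈ TVA (proj₁ (Ss i))
    δ₂-dom : ∀ S n Ss i τ τ' o → δ₂ S n Ss i τ τ' ≡ just o →
             τ ∈ TVC (proj₂ S) × τ' ∈ TVC (proj₂ (Ss i))
    OrdF      : (TA ⊎ TC) → Model → Maybe 𝒪
    𝟙         : 𝒪
    𝟙-lower   : ∀ τ m o → OrdF τ m ≡ just o → 𝟙 ≼ o
    𝟙-attained : Σ (TA ⊎ TC) λ τ → Σ Model λ m → OrdF τ m ≡ just 𝟙
    Excluded  : (S : Ante × Cons) (n : ℕ) (Ss : Fin n → Ante × Cons) → TC → Set
    Excluded-sound : ∀ A C n Ss τ → τ ∈ TVC C → Excluded (A , C) n Ss τ →
                     ∀ m → m ⊨A A → OrdF (inj₂ τ) m ≡ nothing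

module CyclicProofs {OS : OrdinalSegment} (Sys : System OS) where
  open OrdinalSegment OS
  open System Sys

  Sequent : Set
  Sequent = Ante × Cons

  Valid : Sequent → Set
  Valid (A , C) = ∀ m → m ⊨A A → m ⊨C C

  Equates : Sequent → TA → TC → Set
  Equates (A , C) τ τ' = τ ∈ TVA A × τ' ∈ TVC C ×
    (Valid (A , C) → ∀ m → m ⊨A A → ∀ o → OrdF (inj₂ τ') m ≡ just o →
                      OrdF (inj₁ τ) m ≡ just o)

  record PreProof : Set where
    field
      size   : ℕ
      arity  : Fin size → ℕ
      child  : (ν : Fin size) → Fin (arity ν) → Fin size
      seq    : Fin size → Sequent
      rule   : Fin size → RuleIdx
      rule∈  : ∀ ν → r⃗ (rule ν)
      inst   : ∀ ν → Rule (rule ν) (seq ν) (arity ν) (λ i → seq (child ν i))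

  module _ (P : PreProof) where
    open PreProof P

    Node : Set
    Node = Fin size

    Axiomatic : Node → Set
    Axiomatic ν = arity ν ≡ 0

    prem : (ν : Node) → Fin (arity ν) → Sequent
    prem ν i = seq (child ν i)

    δ₁ᴾ : (ν : Node) → Fin (arity ν) → TA → TA → Maybe 𝒪
    δ₁ᴾ ν = δ₁ (seq ν) (arity ν) (prem ν)

    δ₂ᴾ : (ν : Node) → Fin (arity ν) → TC → TC → Maybe 𝒪
    δ₂ᴾ ν = δ₂ (seq ν) (arity ν) (prem ν)

    TVAn : Node → List TA
    TVAn ν = TVA (proj₁ (seq ν))

    TVCn : Node → List TC
    TVCn ν = TVC (proj₂ (seq ν))

    ExcludedBy : Node → TC → Set
    ExcludedBy ν = Excluded (seq ν) (arity ν) (prem ν)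

    Terminal₂ : Node → TC → Set
    Terminal₂ ν τ = ¬ (Σ (Fin (arity ν)) λ i → Σ TC λ τ' → Σ 𝒪 λ o →
                        δ₂ᴾ ν i τ τ' ≡ just o)

    Ground : Node → TC → Set
    Ground ν τ = τ ∈ TVCn ν × Terminal₂ ν τ ×
      (Valid (seq ν) → ∀ m → m ⊨A proj₁ (seq ν) → ∀ o →
         OrdF (inj₂ τ) m ≡ just o → o ≡ 𝟙)

    InT : Node → TC → TA → Set
    InT ν τ x = x ∈ TVAn ν × Equates (seq ν) x τ

    record InfPath : Set where
      field
        node : ℕ → Node
        edge : ∀ i → Fin (arity (node i))
        link : ∀ i → child (node i) (edge i) ≡ node (suc i)

    HasInfProgTrace : InfPath → Set
    HasInfProgTrace p =
      Σ ℕ λ j → Σ (ℕ → TA) λ τs →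
        (∀ i → Σ 𝒪 λ o → δ₁ᴾ (node (j + i)) (edge (j + i)) (τs i) (τs (suc i)) ≡ just o)
        × (∀ N → Σ ℕ λ i → N ≤ i × Σ 𝒪 λ o →
             δ₁ᴾ (node (j + i)) (edge (j + i)) (τs i) (τs (suc i)) ≡ just o × 𝟘 ≺ o)
      where open InfPath p

    IsCyclicProof : Set
    IsCyclicProof = ∀ p → HasInfProgTrace p

    -- the alphabet Σ_𝒫: nodes, and pairs (T, τ) with T a (finite, listed)
    -- set of antecedent trace values
    data Letter : Set where
      nodeL : Node → Letter
      labL  : List TA → TC → Letter

    IsT : List TA → Node → TC → Set
    IsT T ν τ = ∀ x → (x ∈ T → InT ν τ x) × (InT ν τ x → x ∈ T)

    open Automata OS

    module _ (ν₀ : Node) (τ₁ : TA) (τ₂ : TC) where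

      data QA : Set where
        qA   : QA
        botA : QA
        topA : QA
        stA  : Node → TA → QA

      data FinalA : QA → Set where
        fbot : FinalA botA
        ftop : FinalA topA
        fst  : ∀ {ν τ} → FinalA (stA ν τ)

      data TransA : QA → Letter → QA → Maybe 𝒪 → Set where
        init  : TransA qA (nodeL ν₀) (stA ν₀ τ₁) (just 𝟘)
        step  : ∀ {ν τ τ' o} (i : Fin (arity ν)) → δ₁ᴾ ν i τ τ' ≡ just o →
                TransA (stA ν τ) (nodeL (child ν i)) (stA (child ν i) τ') (just o)
        close : ∀ {ν τ τ' T} → Axiomatic ν → τ' ∈ TVCn ν → InT ν τ' τ →
                IsT T ν τ' → TransA (stA ν τ) (labL T τ') botA (just 𝟘)
        toTop : ∀ {ν τ} (i : Fin (arity ν)) →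
                TransA (stA ν τ) (nodeL (child ν i)) topA (just 𝟘)
        topLp : ∀ {ν} → TransA topA (nodeL ν) topA (just 𝟘)

      𝒜 : WAut Letter
      𝒜 = record { Q = QA ; qI = qA ; Final = FinalA ; Trans = TransA }

      ---------------------------------------------------------------- 𝒜(n)
      -- ⊤^i_ν is represented as topN ν j with j : Fin n, i = toℕ j + 1
      module _ (n : ℕ) where
        data QAn : Set where
          qAn   : QAn
          botAn : QAn
          topN  : Node → Fin n → QAn
          stAn  : Node → TA → QAn

        data FinalAn : QAn → Set where
          fbot : FinalAn botAn
          ftop : ∀ {ν j} → FinalAn (topN ν j)
          fst  : ∀ {ν τ} → FinalAn (stAn ν τ)

        data TransAn : QAn → Letter → QAn → Maybe 𝒪 → Set where
          init  : TransAn qAn (nodeL ν₀) (stAn ν₀ τ₁) (just 𝟘)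
          step  : ∀ {ν τ τ' o} (i : Fin (arity ν)) → δ₁ᴾ ν i τ τ' ≡ just o →
                  TransAn (stAn ν τ) (nodeL (child ν i)) (stAn (child ν i) τ') (just o)
          close : ∀ {ν τ τ' T} → Axiomatic ν → τ' ∈ TVCn ν → InT ν τ' τ →
                  IsT T ν τ' → TransAn (stAn ν τ) (labL T τ') botAn (just 𝟘)
          toTop : ∀ {ν τ} (i : Fin (arity ν)) (j : Fin n) → toℕ j ≡ 0 →
                  TransAn (stAn ν τ) (nodeL (child ν i)) (topN (child ν i) j) (just 𝟘)
          topLp : ∀ {ν ν' j} → ν' ≢ ν →
                  TransAn (topN ν j) (nodeL ν') (topN ν j) (just 𝟘)
          topInc : ∀ {ν} (j j' : Fin n) → toℕ j' ≡ suc (toℕ j) →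
                  TransAn (topN ν j) (nodeL ν) (topN ν j') (just 𝟘)

        𝒜n : WAut Letter
        𝒜n = record { Q = QAn ; qI = qAn ; Final = FinalAn ; Trans = TransAn }

      data QB : Set where
        qC   : QB
        botB : QB
        stB  : Node → TC → QB

      data FinalB : QB → Set where
        fbot   : FinalB botB
        fterm  : ∀ {ν τ} → ¬ Axiomatic ν → Terminal₂ ν τ → ¬ ExcludedBy ν τ →
                 FinalB (stB ν τ)
        fground : ∀ {ν τ} → Axiomatic ν → Ground ν τ → ¬ ExcludedBy ν τ →
                 FinalB (stB ν τ)

      data TransB : QB → Letter → QB → Maybe 𝒪 → Set where
        init  : TransB qC (nodeL ν₀) (stB ν₀ τ₂) (just 𝟘)
        step  : ∀ {ν τ τ' o} (i : Fin (arity ν)) → δ₂ᴾ ν i τ τ' ≡ just o →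
                TransB (stB ν τ) (nodeL (child ν i)) (stB (child ν i) τ') (just o)
        close : ∀ {ν τ T} → τ ∈ TVCn ν → Axiomatic ν → ¬ Ground ν τ →
                ¬ ExcludedBy ν τ → IsT T ν τ →
                TransB (stB ν τ) (labL T τ) botB (just 𝟘)

      ℬ : WAut Letter
      ℬ = record { Q = QB ; qI = qC ; Final = FinalB ; Trans = TransB }

-- The automaton 𝒜(n) is a bounded refinement of 𝒜: collapsing every
-- counting state ⊤ⁱ_ν of 𝒜(n) to the single sink ⊤ of 𝒜 maps runs of
-- 𝒜(n) to runs of 𝒜 with the same weights and the same acceptance.
-- Hence every run value of 𝒜(n) over w is a run value of 𝒜 over w, and
-- L_𝒜(n) ≤ L_𝒜.  The theorem then follows by transitivity,
--   L_ℬ(w) ∼ L_𝒜(n)(w) ≤ L_𝒜(w),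
-- provided L_𝒜(n)(w) is actually defined, i.e. the set of run values of
-- 𝒜(n) over w is empty or has a greatest element.  This holds for every
-- finitely branching automaton (classically: we decide acceptance and
-- the existence of transitions with excluded middle).
module Submission where

open import Defs
open import Level using (0ℓ)
open import Data.Nat using (ℕ; _<_)
open import Data.Fin using (Fin)
open import Data.List using (List; []; _∷_; map; _++_; concatMap; allFin)
open import Data.List.Relation.Unary.Any using (here; there)
open import Data.List.Membership.Propositional using (_∈_; lose)
open import Data.List.Membership.Propositional.Properties
  using (∈-map⁺; ∈-++⁺ˡ; ∈-++⁺ʳ; ∈-allFin; ∈-concatMap⁺)
open import Data.Maybe using (just; nothing)
open import Data.Product using (Σ; _×_; _,_; proj₂)
open import Data.Sum using (_⊎_; inj₁; inj₂)
open import Data.Empty using (⊥-elim)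
open import Function using (_∘_)
open import Relation.Nullary using (¬_; Dec; yes; no)
open import Relation.Binary.PropositionalEquality using (_≡_; refl; sym; subst)
open import Relation.Binary.Structures using (IsStrictTotalOrder)
import Relation.Binary.Construct.StrictToNonStrict as StrictToNonStrict
open import Induction.WellFounded using (Acc; acc)
open import Axiom.ExcludedMiddle using (ExcludedMiddle)

module OrdinalFacts (OS : OrdinalSegment) where
  open OrdinalSegment OS
  private
    module STO = IsStrictTotalOrder isSTO
    module NS = StrictToNonStrict {A = 𝒪} _≡_ _≺_

  ≼-trans : ∀ {a b c} → a ≼ b → b ≼ c → a ≼ c
  ≼-trans = NS.trans STO.isEquivalence STO.<-resp-≈ STO.trans

  ≼-≺-trans : ∀ {a b c} → a ≼ b → b ≺ c → a ≺ c
  ≼-≺-trans = NS.≤-<-trans sym STO.trans STO.<-respˡ-≈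

  ≺-≼-trans : ∀ {a b c} → a ≺ b → b ≼ c → a ≺ c
  ≺-≼-trans = NS.<-≤-trans STO.trans STO.<-respʳ-≈

  ≼-total : ∀ a b → a ≼ b ⊎ b ≼ a
  ≼-total = NS.total STO.compare

  -- a ≼ a' ⇒ a + b ≼ a' + b, by well-founded induction on b using the
  -- defining property of ordinal addition as a least upper bound.
  ⊹-monoˡ-≼ : ∀ {a a'} → a ≼ a' → ∀ b → a ⊹ b ≼ a' ⊹ b
  ⊹-monoˡ-≼ {a} {a'} a≼a' b = go b (≺-wf b)
    where
    go : ∀ b → Acc _≺_ b → a ⊹ b ≼ a' ⊹ b
    go b (acc below) =
      ⊹-least a b (a' ⊹ b) (≼-trans a≼a' (⊹-lower a' b))
        (λ c c≺b → ≼-≺-trans (go c (below c≺b)) (⊹-above a' b c c≺b))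

module ValueOrder (OS : OrdinalSegment) where
  open OrdinalSegment OS
  open OrdSemiring OS
  open OrdinalFacts OS

  ≤v-refl : ∀ {x} → x ≤v x
  ≤v-refl {nothing} = ⊥≤
  ≤v-refl {just a}  = j≤j (inj₂ refl)

  ≤v-trans : ∀ {x y z} → x ≤v y → y ≤v z → x ≤v z
  ≤v-trans ⊥≤        _         = ⊥≤
  ≤v-trans (j≤j a≼b) (j≤j b≼c) = j≤j (≼-trans a≼b b≼c)

  <v-≤v-trans : ∀ {x y z} → x <v y → y ≤v z → x <v z
  <v-≤v-trans ⊥<        (j≤j _)   = ⊥<
  <v-≤v-trans (j<j a≺b) (j≤j b≼c) = j<j (≺-≼-trans a≺b b≼c)

  ≤v-total : ∀ x y → x ≤v y ⊎ y ≤v x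
  ≤v-total nothing  _        = inj₁ ⊥≤
  ≤v-total (just a) nothing  = inj₂ ⊥≤
  ≤v-total (just a) (just b) with ≼-total a b
  ... | inj₁ a≼b = inj₁ (j≤j a≼b)
  ... | inj₂ b≼a = inj₂ (j≤j b≼a)

  ⊗-⊥ : ∀ g → g ⊗ ⊥v ≡ ⊥v
  ⊗-⊥ nothing  = refl
  ⊗-⊥ (just _) = refl

  ⊗-monoʳ-≤v : ∀ g {x y} → x ≤v y → (g ⊗ x) ≤v (g ⊗ y)
  ⊗-monoʳ-≤v nothing  _         = ⊥≤
  ⊗-monoʳ-≤v (just a) ⊥≤        = ⊥≤
  ⊗-monoʳ-≤v (just a) (j≤j x≼y) = j≤j (⊹-monoˡ-≼ x≼y a)

-- The
-- value of an automaton's language is the greatest run value, so we need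
-- this property closed under the operations that build run-value sets.
module Maxima (OS : OrdinalSegment) where
  open OrdSemiring OS
  open ValueOrder OS

  IsGreatest : (V → Set) → V → Set
  IsGreatest R m = R m × (∀ y → R y → y ≤v m)

  EmptyOrMax : (V → Set) → Set
  EmptyOrMax R = (¬ Σ V R) ⊎ Σ V (IsGreatest R)

  emptyOrMax-resp : {R S : V → Set} → (∀ y → R y → S y) → (∀ y → S y → R y) →
                    EmptyOrMax R → EmptyOrMax S
  emptyOrMax-resp R⇒S S⇒R (inj₁ empty) = inj₁ λ (y , s) → empty (y , S⇒R y s)
  emptyOrMax-resp R⇒S S⇒R (inj₂ (m , r , bound)) =
    inj₂ (m , R⇒S m r , λ y s → bound y (S⇒R y s))

  emptyOrMax-singleton : ∀ v → EmptyOrMax (_≡ v)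
  emptyOrMax-singleton v = inj₂ (v , refl , λ { _ refl → ≤v-refl })

  emptyOrMax-guard : {T : Set} {R : V → Set} → Dec T → EmptyOrMax R →
                     EmptyOrMax (λ y → T × R y)
  emptyOrMax-guard (no ¬t) _ = inj₁ λ (_ , t , _) → ¬t t
  emptyOrMax-guard (yes t) (inj₁ empty) = inj₁ λ (y , _ , r) → empty (y , r)
  emptyOrMax-guard (yes t) (inj₂ (m , r , bound)) =
    inj₂ (m , (t , r) , λ y (_ , r') → bound y r')

  emptyOrMax-⊎ : {R S : V → Set} → EmptyOrMax R → EmptyOrMax S →
                 EmptyOrMax (λ y → R y ⊎ S y)
  emptyOrMax-⊎ (inj₁ ¬R) (inj₁ ¬S) =
    inj₁ λ { (y , inj₁ r) → ¬R (y , r) ; (y , inj₂ s) → ¬S (y , s) }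
  emptyOrMax-⊎ (inj₁ ¬R) (inj₂ (m , s , bound)) =
    inj₂ (m , inj₂ s , λ { y (inj₁ r) → ⊥-elim (¬R (y , r)) ; y (inj₂ s') → bound y s' })
  emptyOrMax-⊎ (inj₂ (m , r , bound)) (inj₁ ¬S) =
    inj₂ (m , inj₁ r , λ { y (inj₁ r') → bound y r' ; y (inj₂ s) → ⊥-elim (¬S (y , s)) })
  emptyOrMax-⊎ (inj₂ (m₁ , r , bound₁)) (inj₂ (m₂ , s , bound₂)) with ≤v-total m₁ m₂
  ... | inj₁ m₁≤m₂ = inj₂ (m₂ , inj₂ s ,
          λ { y (inj₁ r') → ≤v-trans (bound₁ y r') m₁≤m₂ ; y (inj₂ s') → bound₂ y s' })
  ... | inj₂ m₂≤m₁ = inj₂ (m₁ , inj₁ r ,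
          λ { y (inj₁ r') → bound₁ y r' ; y (inj₂ s') → ≤v-trans (bound₂ y s') m₂≤m₁ })

  -- the image of R under x ↦ g ⊗ x (maxima are preserved by monotonicity)
  emptyOrMax-⊗ : {R : V → Set} (g : V) → EmptyOrMax R →
                 EmptyOrMax (λ y → Σ V λ x → R x × y ≡ g ⊗ x)
  emptyOrMax-⊗ g (inj₁ empty) = inj₁ λ (_ , x , r , _) → empty (x , r)
  emptyOrMax-⊗ g (inj₂ (m , r , bound)) =
    inj₂ (g ⊗ m , (m , r , refl) , λ { _ (x , r' , refl) → ⊗-monoʳ-≤v g (bound x r') })

  emptyOrMax-⋃ : {I : Set} {R : I → V → Set} (is : List I) →
                 (∀ i → EmptyOrMax (R i)) →
                 EmptyOrMax (λ y → Σ I λ i → i ∈ is × R i y)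
  emptyOrMax-⋃ []       _     = inj₁ λ { (_ , _ , () , _) }
  emptyOrMax-⋃ {R = R} (i ∷ is) each =
    emptyOrMax-resp head-or-tail split (emptyOrMax-⊎ (each i) (emptyOrMax-⋃ is each))
    where
    head-or-tail : ∀ y → R i y ⊎ (Σ _ λ j → j ∈ is × R j y) → Σ _ λ j → j ∈ i ∷ is × R j y
    head-or-tail y (inj₁ r)           = i , here refl , r
    head-or-tail y (inj₂ (j , j∈ , r)) = j , there j∈ , r

    split : ∀ y → (Σ _ λ j → j ∈ i ∷ is × R j y) → R i y ⊎ (Σ _ λ j → j ∈ is × R j y)
    split y (j , here refl , r) = inj₁ r
    split y (j , there j∈ , r)  = inj₂ (j , j∈ , r)

module FinitelyBranching (OS : OrdinalSegment) (lem : ExcludedMiddle 0ℓ)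
  {Sig : Set} (A : Automata.WAut OS Sig)
  (successors : Automata.WAut.Q A → List (Automata.WAut.Q A × OrdSemiring.V OS))
  (successors-complete : ∀ {q σ q' g} → Automata.WAut.Trans A q σ q' g →
                         (q' , g) ∈ successors q)
  where
  open OrdinalSegment OS
  open OrdSemiring OS
  open Automata OS
  open WAut A
  open ValueOrder OS
  open Maxima OS

  RunValueFrom : Q → List Sig → V → Set
  RunValueFrom q w x = Σ Q λ q' → Σ V λ v → Path A q w q' v ×
                       ((Final q' × x ≡ v) ⊎ (¬ Final q' × x ≡ ⊥v))

  path⇒runValue : ∀ {q w q' v} → Path A q w q' v → Σ V (RunValueFrom q w)
  path⇒runValue {q' = q'} {v} p with lem {Final q'}
  ... | yes f  = v  , q' , v , p , inj₁ (f , refl)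
  ... | no ¬f = ⊥v , q' , v , p , inj₂ (¬f , refl)

  RunValueVia : Q → Sig → List Sig → Q × V → V → Set
  RunValueVia q σ w (q' , g) y = Trans q σ q' g × Σ V λ x → RunValueFrom q' w x × y ≡ g ⊗ x

  runValue-∷⇒ : ∀ {q σ w} y → RunValueFrom q (σ ∷ w) y →
                Σ (Q × V) λ e → e ∈ successors q × RunValueVia q σ w e y
  runValue-∷⇒ y (q'' , _ , t ∷ p , inj₁ (f , refl)) =
    _ , successors-complete t , t , _ , (q'' , _ , p , inj₁ (f , refl)) , refl
  runValue-∷⇒ y (q'' , _ , _∷_ {g = g} t p , inj₂ (¬f , refl)) =
    _ , successors-complete t , t , ⊥v , (q'' , _ , p , inj₂ (¬f , refl)) , sym (⊗-⊥ g)

  runValue-∷⇐ : ∀ {q σ w} y → (Σ (Q × V) λ e → e ∈ successors q × RunValueVia q σ w e y) →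
                RunValueFrom q (σ ∷ w) y
  runValue-∷⇐ _ ((_ , g) , _ , t , _ , (q'' , v , p , inj₁ (f , refl)) , refl) =
    q'' , g ⊗ v , t ∷ p , inj₁ (f , refl)
  runValue-∷⇐ _ ((_ , g) , _ , t , _ , (q'' , v , p , inj₂ (¬f , refl)) , refl) =
    q'' , g ⊗ v , t ∷ p , inj₂ (¬f , ⊗-⊥ g)

  runValue-[]⇒ : ∀ {q} y → RunValueFrom q [] y →
                 (Final q × y ≡ just 𝟘) ⊎ (¬ Final q × y ≡ ⊥v)
  runValue-[]⇒ y (_ , _ , [] , c) = c

  runValue-[]⇐ : ∀ {q} y → (Final q × y ≡ just 𝟘) ⊎ (¬ Final q × y ≡ ⊥v) →
                 RunValueFrom q [] y
  runValue-[]⇐ {q} y c = q , just 𝟘 , [] , c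

  runValues-emptyOrMax : ∀ w q → EmptyOrMax (RunValueFrom q w)
  runValues-emptyOrMax [] q =
    emptyOrMax-resp runValue-[]⇐ runValue-[]⇒
      (emptyOrMax-⊎ (emptyOrMax-guard lem (emptyOrMax-singleton (just 𝟘)))
                    (emptyOrMax-guard lem (emptyOrMax-singleton ⊥v)))
  runValues-emptyOrMax (σ ∷ w) q =
    emptyOrMax-resp runValue-∷⇐ runValue-∷⇒
      (emptyOrMax-⋃ (successors q) λ (q' , g) →
         emptyOrMax-guard lem (emptyOrMax-⊗ g (runValues-emptyOrMax w q')))

  language-total : ∀ w → Σ V (IsL A w)
  language-total w with runValues-emptyOrMax w qI
  ... | inj₁ empty = ⊥v , inj₁ ((λ (_ , _ , p) → empty (path⇒runValue p)) , refl)
  ... | inj₂ (m , greatest) = m , inj₂ greatest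

module Simulations (OS : OrdinalSegment) {Sig : Set} (A B : Automata.WAut OS Sig) where
  open OrdSemiring OS
  open Automata OS
  open WAut
  open ValueOrder OS

  record Simulation : Set where
    field
      ⟦_⟧         : Q A → Q B
      ⟦⟧-initial  : ⟦ qI A ⟧ ≡ qI B
      ⟦⟧-trans    : ∀ {q σ q' g} → Trans A q σ q' g → Trans B ⟦ q ⟧ σ ⟦ q' ⟧ g
      ⟦⟧-final    : ∀ {q} → Final A q → Final B ⟦ q ⟧
      ⟦⟧-nonfinal : ∀ {q} → Final B ⟦ q ⟧ → Final A q

  -- Every run value of A is a run value of B, hence L_A ≤ L_B.
  simulation⇒≤ : Simulation → LangCmp le A B
  simulation⇒≤ sim w y z LA LB = compare LA LB
    where
    open Simulation sim

    ⟦_⟧-path : ∀ {q w q' v} → Path A q w q' v → Path B ⟦ q ⟧ w ⟦ q' ⟧ v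
    ⟦ [] ⟧-path    = []
    ⟦ t ∷ p ⟧-path = ⟦⟧-trans t ∷ ⟦ p ⟧-path

    ⟦_⟧-run : ∀ {w q' v} → Path A (qI A) w q' v → Path B (qI B) w ⟦ q' ⟧ v
    ⟦ p ⟧-run = subst (λ q → Path B q _ _ _) ⟦⟧-initial ⟦ p ⟧-path

    ⟦_⟧-value : ∀ {w x} → RunValue A w x → RunValue B w x
    ⟦ q , v , p , inj₁ (f , e)  ⟧-value = ⟦ q ⟧ , v , ⟦ p ⟧-run , inj₁ (⟦⟧-final f , e)
    ⟦ q , v , p , inj₂ (¬f , e) ⟧-value = ⟦ q ⟧ , v , ⟦ p ⟧-run , inj₂ (¬f ∘ ⟦⟧-nonfinal , e)

    compare : IsL A w y → IsL B w z → y ≤v z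
    compare (inj₁ (_ , refl)) _ = ⊥≤
    compare (inj₂ (rv , _)) (inj₁ (noRun , _)) =
      let (q , v , p , _) = ⟦ rv ⟧-value in ⊥-elim (noRun (q , v , p))
    compare (inj₂ (rv , _)) (inj₂ (_ , greatest)) = greatest y ⟦ rv ⟧-value

langCmp-≤-trans : (OS : OrdinalSegment) {Sig : Set} (∼ : Automata.Cmp OS)
  {B A₁ A₂ : Automata.WAut OS Sig} →
  Automata.LangCmp OS ∼ B A₁ →
  (∀ w → Σ (OrdSemiring.V OS) (Automata.IsL OS A₁ w)) →
  Automata.LangCmp OS Automata.le A₁ A₂ →
  Automata.LangCmp OS ∼ B A₂
langCmp-≤-trans OS Automata.le B≤A₁ L₁ A₁≤A₂ w x z LB LA₂ =
  let (y , LA₁) = L₁ w in ValueOrder.≤v-trans OS (B≤A₁ w x y LB LA₁) (A₁≤A₂ w y z LA₁ LA₂)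
langCmp-≤-trans OS Automata.lt B<A₁ L₁ A₁≤A₂ w x z LB LA₂ x≢⊥ =
  let (y , LA₁) = L₁ w in ValueOrder.<v-≤v-trans OS (B<A₁ w x y LB LA₁ x≢⊥) (A₁≤A₂ w y z LA₁ LA₂)

module BoundedAutomaton (OS : OrdinalSegment) (Sys : System OS)
  (P : CyclicProofs.PreProof Sys) (ν₀ : CyclicProofs.Node Sys P)
  (τ₁ : System.TA Sys) (τ₂ : System.TC Sys) (n : ℕ) where
  open OrdinalSegment OS
  open OrdSemiring OS
  open System Sys
  open CyclicProofs Sys
  open CyclicProofs.PreProof P

  collapse : QAn P ν₀ τ₁ τ₂ n → QA P ν₀ τ₁ τ₂
  collapse qAn        = qA
  collapse botAn      = botA
  collapse (topN _ _) = topA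
  collapse (stAn ν τ) = stA ν τ

  collapse-trans : ∀ {q σ q' g} → TransAn P ν₀ τ₁ τ₂ n q σ q' g →
                   TransA P ν₀ τ₁ τ₂ (collapse q) σ (collapse q') g
  collapse-trans init              = init
  collapse-trans (step i δ≡)       = step i δ≡
  collapse-trans (close ax τ∈ eq T) = close ax τ∈ eq T
  collapse-trans (toTop i _ _)     = toTop i
  collapse-trans (topLp _)         = topLp
  collapse-trans (topInc _ _ _)    = topLp

  collapse-final : ∀ {q} → FinalAn P ν₀ τ₁ τ₂ n q → FinalA P ν₀ τ₁ τ₂ (collapse q)
  collapse-final fbot = fbot
  collapse-final ftop = ftop
  collapse-final fst  = fst

  -- the initial state is the only non-accepting state of either automaton
  collapse-nonfinal : ∀ {q} → FinalA P ν₀ τ₁ τ₂ (collapse q) → FinalAn P ν₀ τ₁ τ₂ n q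
  collapse-nonfinal {botAn}     _ = fbot
  collapse-nonfinal {topN _ _}  _ = ftop
  collapse-nonfinal {stAn _ _}  _ = fst

  𝒜n↪𝒜 : Simulations.Simulation OS (𝒜n P ν₀ τ₁ τ₂ n) (𝒜 P ν₀ τ₁ τ₂)
  𝒜n↪𝒜 = record
    { ⟦_⟧         = collapse
    ; ⟦⟧-initial  = refl
    ; ⟦⟧-trans    = collapse-trans
    ; ⟦⟧-final    = collapse-final
    ; ⟦⟧-nonfinal = collapse-nonfinal
    }

  tops : Node P → List (QAn P ν₀ τ₁ τ₂ n × V)
  tops ν = map (λ j → topN ν j , just 𝟘) (allFin n)

  traceStep : (ν : Node P) → TA → (i : Fin (arity ν)) → TA → QAn P ν₀ τ₁ τ₂ n × V
  traceStep ν τ i τ' = stAn (child ν i) τ' , δ₁ᴾ P ν i τ τ'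

  childSuccessors : (ν : Node P) → TA → Fin (arity ν) → List (QAn P ν₀ τ₁ τ₂ n × V)
  childSuccessors ν τ i = tops (child ν i) ++ map (traceStep ν τ i) (TVAn P (child ν i))

  successors : QAn P ν₀ τ₁ τ₂ n → List (QAn P ν₀ τ₁ τ₂ n × V)
  successors qAn        = (stAn ν₀ τ₁ , just 𝟘) ∷ []
  successors botAn      = []
  successors (topN ν _) = tops ν
  successors (stAn ν τ) = (botAn , just 𝟘) ∷ concatMap (childSuccessors ν τ) (allFin (arity ν))

  ∈-tops : ∀ ν j → (topN ν j , just 𝟘) ∈ tops ν
  ∈-tops ν j = ∈-map⁺ (λ j → topN ν j , just 𝟘) (∈-allFin j)

  ∈-childSuccessors : ∀ {ν τ x} i → x ∈ childSuccessors ν τ i →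
                      x ∈ successors (stAn ν τ)
  ∈-childSuccessors {ν} {τ} i x∈ =
    there (∈-concatMap⁺ (childSuccessors ν τ) (lose (∈-allFin i) x∈))

  -- every transition of 𝒜(n) is listed; a trace step (τ, τ') is, because
  -- δ₁ is only defined on trace values of the two sequents involved
  successors-complete : ∀ {q σ q' g} → TransAn P ν₀ τ₁ τ₂ n q σ q' g →
                        (q' , g) ∈ successors q
  successors-complete init = here refl
  successors-complete (close _ _ _ _) = here refl
  successors-complete {stAn ν τ} (step {τ' = τ'} i δ≡) =
    ∈-childSuccessors i (∈-++⁺ʳ (tops (child ν i))
      (subst (λ g → (stAn (child ν i) τ' , g) ∈ map (traceStep ν τ i) (TVAn P (child ν i))) δ≡
        (∈-map⁺ (traceStep ν τ i) (proj₂ (δ₁-dom (seq ν) (arity ν) (prem P ν) i τ τ' _ δ≡)))))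
  successors-complete (toTop i j _) = ∈-childSuccessors i (∈-++⁺ˡ (∈-tops _ j))
  successors-complete {topN ν j} (topLp _)        = ∈-tops ν j
  successors-complete {topN ν _} (topInc _ j' _) = ∈-tops ν j'

mainTheorem9 : (OS : OrdinalSegment) (Sys : System OS) →
    ExcludedMiddle 0ℓ →
    (P : CyclicProofs.PreProof Sys) → CyclicProofs.IsCyclicProof Sys P →
    (ν : CyclicProofs.Node Sys P) (τ : System.TA Sys) (τ' : System.TC Sys) →
    τ ∈ CyclicProofs.TVAn Sys P ν → τ' ∈ CyclicProofs.TVCn Sys P ν →
    (n : ℕ) → 0 < n → (∼ : Automata.Cmp OS) →
    Automata.LangCmp OS ∼ (CyclicProofs.ℬ Sys P ν τ τ') (CyclicProofs.𝒜n Sys P ν τ τ' n) →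
    Automata.LangCmp OS ∼ (CyclicProofs.ℬ Sys P ν τ τ') (CyclicProofs.𝒜 Sys P ν τ τ')
mainTheorem9 OS Sys lem P _ ν τ τ' _ _ n _ ∼ ℬ∼𝒜n =
  langCmp-≤-trans OS ∼ ℬ∼𝒜n 𝒜n-total 𝒜n≤𝒜
  where
  open BoundedAutomaton OS Sys P ν τ τ' n

  𝒜n-total : ∀ w → Σ (OrdSemiring.V OS)
                      (Automata.IsL OS (CyclicProofs.𝒜n Sys P ν τ τ' n) w)
  𝒜n-total = FinitelyBranching.language-total OS lem _ successors successors-complete

  𝒜n≤𝒜 : Automata.LangCmp OS Automata.le (CyclicProofs.𝒜n Sys P ν τ τ' n)
                                          (CyclicProofs.𝒜 Sys P ν τ τ')
  𝒜n≤𝒜 = Simulations.simulation⇒≤ OS _ _ 𝒜n↪𝒜
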